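{- Let $G=(A\cup B,E)$ be a marriage instance with strict preferences, and suppose the graph $H$ admits a legal stable matching. Let $S_0$ be the $(A_L\cup B_L)$-optimal legal stable matching of $H$, and let $B_+=\{b\in B:(a_\ell^-,b_r^+)\in S_0\text{ for some }a\in A\}$ and $B'_-=\{b\in B:(b_\ell^-,a_r^+)\in S_0\text{ for some }a\in A\}$. Let $N$ be a fully popular matching in $G$ and let $\vec\alpha$ be any witness of $N$. Then $\alpha_b=0$ for every $b\in B_+\cap B'_-$.
   Context: $G=(A\cup B,E)$ is bipartite, every vertex has a strict ranking of its neighbors. Augment $G$ with a self-loop $(u,u)$ at every vertex, ranked last by $u$; $E'=E\cup\{(u,u)\}$; matchings are viewed as perfect matchings of $(A\cup B,E')$ (uncovered vertices matched to themselves). For matchings $M,N$, $\phi(M,N)$ (resp. $\phi_A(M,N)$) is the number of vertices of $A\cup B$ (resp. of $A$) that get a better assignment in $M$ than in $N$. $M$ is popular if $\phi(M,N)\ge\phi(N,M)$ for all $N$, $A$-popular if $\phi_A(M,N)\ge\phi_A(N,M)$ for all $N$, fully popular if both. For a perfect matching $N$ of $(A\cup B,E')$ define $\mathsf{wt}_N$: for $(a,b)\in E$, $\mathsf{wt}_N(a,b)=2$ if $a$ and $b$ both prefer each other to their partners in $N$, $-2$ if both prefer their partners in $N$ to each other, and $0$ otherwise; for a self-loop, $\mathsf{wt}_N(u,u)=0$ if $(u,u)\in N$ and $-1$ otherwise. A witness of a popular matching $N$ is a vector $\vec\alpha\in\{0,\pm1\}^{A\cup B}$ with $\sum_u\alpha_u=0$,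 $\alpha_a+\alpha_b\ge\mathsf{wt}_N(a,b)$ for all $(a,b)\in E$, and $\alpha_u\ge\mathsf{wt}_N(u,u)$ for all $u$. For $a\in A$, $f(a)$ is $a$'s top-ranked neighbor, and $s(a)$ is $a$'s most preferred neighbor in $E'$ (possibly $a$ itself) that is not $f(a')$ for any $a'\in A$. Valid: elements of $\{(a,f(a)),(a,s(a)):a\in A\}$ and self-loops $(b,b)$ with $b\in B$, $b\ne f(a)$ for all $a$. An edge $(a,b)\in E$ is popular if some popular matching contains it; $(u,u)$ is popular if some popular matching leaves $u$ unmatched. Legal = valid and popular. The graph $H$: vertices $u_\ell,u_r$ for each $u\in A\cup B$; $A_L=\{a_\ell\}$, $B_L=\{b_\ell\}$ (left side), $A_R,B_R$ (right side). For each $(a,b)\in E$, edges $(a_\ell^+,b_r^-)$, $(a_\ell^-,b_r^+)$, $(b_\ell^+,a_r^-)$, $(b_\ell^-,a_r^+)$; for each $u$, an edge $(u_\ell^-,u_r^+)$. Preferences: if $u$ ranks $v\succ v'\succ\cdots\succ v''$ in $G$, then $u_\ell$ ranks $v_r^-\succ\cdots\succ v_r''^-\succ v_r^+\succ\cdots\succ v_r''^+\succ u_r^+$ and $u_r$ ranks $v_\ell^-\succ\cdots\succ v_\ell''^-\succ u_\ell^-\succ v_\ell^+\succ\cdots\succ v_\ell''^+$ (here $y^\tau$ denotes the edge to $y$ on which $y$'s endpoint has superscript $\tau$). An edge $(x^\sigma,y^\tau)$ blocks a matching if $x$ prefers $y^\tau$ and $y$ prefers $x^\sigma$ to their current assignments;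 stable = no blocking edge. Forbidden edges of $H$: the four edges from a non-legal $(a,b)\in E$, and $(u_\ell^-,u_r^+)$ for non-legal $(u,u)$. A matching of $H$ is legal if it has no forbidden edge. The $(A_L\cup B_L)$-optimal legal stable matching is the legal stable matching of $H$ in which every vertex of $A_L\cup B_L$ is matched along the edge it most prefers among the edges it is matched along in all legal stable matchings of $H$. -}

module Defs where

open import Data.Nat using (ℕ; zero; suc; _<_; _≤_; _<ᵇ_)
open import Data.Fin using (Fin; zero; suc)
open import Data.Bool using (Bool; true; false; if_then_else_; _∧_)
open import Data.Maybe using (Maybe; just; nothing)
open import Data.Sum using (_⊎_; inj₁; inj₂)
open import Data.Product using (Σ; _×_; ∃; ∃-syntax)
open import Data.Empty using (⊥)
open import Data.Unit using (⊤)
open import Data.Integer as ℤ using (ℤ; +_; -[1+_])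
open import Relation.Nullary using (¬_)
open import Relation.Binary.PropositionalEquality using (_≡_)

countF : ∀ {n} → (Fin n → Bool) → ℕ
countF {zero}  p = 0
countF {suc n} p = (if p zero then 1 else 0) Data.Nat.+ countF (λ i → p (suc i))

sumℤ : ∀ {n} → (Fin n → ℤ) → ℤ
sumℤ {zero}  f = + 0
sumℤ {suc n} f = f zero ℤ.+ sumℤ (λ i → f (suc i))

-- Preferences are given by ranks (smaller = better);
-- strictness = ranks of distinct neighbours differ.
-- The self-loop of every vertex is ranked last (encoded as `nothing`).

record Instance : Set where
  field
    nA nB   : ℕ
    E       : Fin nA → Fin nB → Bool
    rankA   : Fin nA → Fin nB → ℕ
    rankB   : Fin nB → Fin nA → ℕ
    strictA : ∀ a b b' → E a b ≡ true → E a b' ≡ true →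
              rankA a b ≡ rankA a b' → b ≡ b'
    strictB : ∀ b a a' → E a b ≡ true → E a' b ≡ true →
              rankB b a ≡ rankB b a' → a ≡ a'

V : ℕ → ℕ → Set
V nA nB = Fin nA ⊎ Fin nB

data Sign : Set where
  plus minus : Sign

-- Edges of H.  `nbr x v σ` is the edge between x_ℓ and v_r with sign σ at
-- x_ℓ (and the opposite sign at v_r); for (a,b) ∈ E these give
-- (a_ℓ^+,b_r^-), (a_ℓ^-,b_r^+), (b_ℓ^+,a_r^-), (b_ℓ^-,a_r^+).
-- `self u` is the edge (u_ℓ^-, u_r^+).
data HEdge (nA nB : ℕ) : Set where
  nbr  : V nA nB → V nA nB → Sign → HEdge nA nB
  self : V nA nB → HEdge nA nB

module Theory (I : Instance) where
  open Instance I

  -- Matchings of G (uncovered vertex = matched to its self-loop = nothing)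

  record Matching : Set where
    field
      pA : Fin nA → Maybe (Fin nB)
      pB : Fin nB → Maybe (Fin nA)
      pA-ok : ∀ a b → pA a ≡ just b → E a b ≡ true × pB b ≡ just a
      pB-ok : ∀ b a → pB b ≡ just a → pA a ≡ just b
  open Matching public

  betterA : Fin nA → Maybe (Fin nB) → Maybe (Fin nB) → Bool
  betterA a (just b) (just b') = rankA a b <ᵇ rankA a b'
  betterA a (just b) nothing   = true
  betterA a nothing  _         = false

  betterB : Fin nB → Maybe (Fin nA) → Maybe (Fin nA) → Bool
  betterB b (just a) (just a') = rankB b a <ᵇ rankB b a'
  betterB b (just a) nothing   = true
  betterB b nothing  _         = false

  φA : Matching → Matching → ℕ
  φA M N = countF (λ a → betterA a (pA M a) (pA N a))

  φ : Matching → Matching → ℕ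
  φ M N = φA M N Data.Nat.+ countF (λ b → betterB b (pB M b) (pB N b))

  Popular : Matching → Set
  Popular M = ∀ N → φ N M ≤ φ M N

  APopular : Matching → Set
  APopular M = ∀ N → φA N M ≤ φA M N

  FullyPopular : Matching → Set
  FullyPopular M = Popular M × APopular M

  wt : Matching → Fin nA → Fin nB → ℤ
  wt N a b =
    if betterA a (just b) (pA N a) ∧ betterB b (just a) (pB N b) then + 2
    else if betterA a (pA N a) (just b) ∧ betterB b (pB N b) (just a) then -[1+ 1 ]
    else + 0

  wtLoopA : Matching → Fin nA → ℤ
  wtLoopA N a with pA N a
  ... | nothing = + 0
  ... | just _  = -[1+ 0 ]

  wtLoopB : Matching → Fin nB → ℤ
  wtLoopB N b with pB N b
  ... | nothing = + 0
  ... | just _  = -[1+ 0 ]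

  In01 : ℤ → Set
  In01 x = x ≡ + 0 ⊎ x ≡ + 1 ⊎ x ≡ -[1+ 0 ]

  Witness : Matching → (Fin nA → ℤ) → (Fin nB → ℤ) → Set
  Witness N αA αB =
    (∀ a → In01 (αA a)) × (∀ b → In01 (αB b)) ×
    (sumℤ αA ℤ.+ sumℤ αB ≡ + 0) ×
    (∀ a b → E a b ≡ true → wt N a b ℤ.≤ αA a ℤ.+ αB b) ×
    (∀ a → wtLoopA N a ℤ.≤ αA a) ×
    (∀ b → wtLoopB N b ℤ.≤ αB b)

  IsF : Fin nA → Fin nB → Set
  IsF a b = E a b ≡ true × (∀ b' → E a b' ≡ true → rankA a b ≤ rankA a b')

  NotF : Fin nB → Set
  NotF b = ∀ a → ¬ IsF a b

  -- s(a) = p  (p = nothing means s(a) = a itself)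
  IsS : Fin nA → Maybe (Fin nB) → Set
  IsS a (just b) = E a b ≡ true × NotF b ×
                   (∀ b' → E a b' ≡ true → NotF b' → rankA a b ≤ rankA a b')
  IsS a nothing  = ∀ b' → E a b' ≡ true → ¬ NotF b'

  ValidEdge : Fin nA → Fin nB → Set
  ValidEdge a b = IsF a b ⊎ IsS a (just b)

  ValidLoopA : Fin nA → Set
  ValidLoopA a = IsS a nothing

  ValidLoopB : Fin nB → Set
  ValidLoopB b = NotF b

  PopularEdge : Fin nA → Fin nB → Set
  PopularEdge a b = ∃[ M ] Popular M × pA M a ≡ just b

  PopularLoopA : Fin nA → Set
  PopularLoopA a = ∃[ M ] Popular M × pA M a ≡ nothing

  PopularLoopB : Fin nB → Set
  PopularLoopB b = ∃[ M ] Popular M × pB M b ≡ nothing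

  LegalEdge : Fin nA → Fin nB → Set
  LegalEdge a b = E a b ≡ true × ValidEdge a b × PopularEdge a b

  LegalLoopA : Fin nA → Set
  LegalLoopA a = ValidLoopA a × PopularLoopA a

  LegalLoopB : Fin nB → Set
  LegalLoopB b = ValidLoopB b × PopularLoopB b

  VG : Set
  VG = V nA nB

  Edge : Set
  Edge = HEdge nA nB

  Adj : VG → VG → Set
  Adj (inj₁ a) (inj₂ b) = E a b ≡ true
  Adj (inj₂ b) (inj₁ a) = E a b ≡ true
  Adj _        _        = ⊥

  IsHEdge : Edge → Set
  IsHEdge (nbr x v σ) = Adj x v
  IsHEdge (self u)    = ⊤

  -- left endpoint (index u of u_ℓ) and right endpoint (index v of v_r)
  left : Edge → VG
  left (nbr x v σ) = x
  left (self u)    = u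

  right : Edge → VG
  right (nbr x v σ) = v
  right (self u)    = u

  rankV : VG → VG → ℕ
  rankV (inj₁ a) (inj₂ b) = rankA a b
  rankV (inj₂ b) (inj₁ a) = rankB b a
  rankV _        _        = 0

  -- u_ℓ : v_r^- (= edges with + at u_ℓ) ≻ v_r^+ (edges with - at u_ℓ) ≻ u_r^+
  tierL : Edge → ℕ
  tierL (nbr x v plus)  = 0
  tierL (nbr x v minus) = 1
  tierL (self u)        = 2

  -- u_r : v_ℓ^- ≻ u_ℓ^- ≻ v_ℓ^+
  tierR : Edge → ℕ
  tierR (nbr x v minus) = 0
  tierR (self u)        = 1
  tierR (nbr x v plus)  = 2

  prefL : Edge → Edge → Set
  prefL e e' = tierL e < tierL e' ⊎
               (tierL e ≡ tierL e' × rankV (left e) (right e) < rankV (left e) (right e'))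

  prefR : Edge → Edge → Set
  prefR e e' = tierR e < tierR e' ⊎
               (tierR e ≡ tierR e' × rankV (right e) (left e) < rankV (right e) (left e'))

  MatchingH : (Edge → Bool) → Set
  MatchingH S =
    (∀ e → S e ≡ true → IsHEdge e) ×
    (∀ e e' → S e ≡ true → S e' ≡ true → left e ≡ left e' → e ≡ e') ×
    (∀ e e' → S e ≡ true → S e' ≡ true → right e ≡ right e' → e ≡ e')

  -- e blocks S: both endpoints strictly prefer e to their current
  -- assignment (an unmatched vertex prefers every edge)
  Blocking : (Edge → Bool) → Edge → Set
  Blocking S e =
    IsHEdge e ×
    (∀ e' → S e' ≡ true → left e' ≡ left e → prefL e e') ×
    (∀ e' → S e' ≡ true → right e' ≡ right e → prefR e e')

  Stable : (Edge → Bool) → Set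
  Stable S = MatchingH S × (∀ e → ¬ Blocking S e)

  LegalHEdge : Edge → Set
  LegalHEdge (nbr (inj₁ a) (inj₂ b) σ) = LegalEdge a b
  LegalHEdge (nbr (inj₂ b) (inj₁ a) σ) = LegalEdge a b
  LegalHEdge (nbr _ _ σ)               = ⊥
  LegalHEdge (self (inj₁ a))           = LegalLoopA a
  LegalHEdge (self (inj₂ b))           = LegalLoopB b

  LegalH : (Edge → Bool) → Set
  LegalH S = ∀ e → S e ≡ true → LegalHEdge e

  LegalStable : (Edge → Bool) → Set
  LegalStable S = Stable S × LegalH S

  LeftOptimalLegalStable : (Edge → Bool) → Set
  LeftOptimalLegalStable S0 =
    LegalStable S0 ×
    (∀ S → LegalStable S → ∀ e → S e ≡ true →
       Σ Edge (λ e0 → S0 e0 ≡ true × left e0 ≡ left e × (e0 ≡ e ⊎ prefL e0 e)))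

  InBplus : (Edge → Bool) → Fin nB → Set
  InBplus S0 b = ∃[ a ] S0 (nbr (inj₁ a) (inj₂ b) minus) ≡ true

  InB'minus : (Edge → Bool) → Fin nB → Set
  InB'minus S0 b = ∃[ a ] S0 (nbr (inj₂ b) (inj₁ a) minus) ≡ true

{-# OPTIONS --safe #-}
module Submission where

-- A fully popular N with witness α induces a matching S_N of H: for (x,v) ∈ N the edge between x_ℓ
-- and v_r with sign + at x_ℓ iff α_x = 1, and (u_ℓ^-, u_r^+) for unmatched u. Complementary slackness
-- (α_a + α_b = 0 on N, α_u = 0 off N, from ∑ α = 0 and the covering constraints) makes S_N stable, and
-- A-popularity makes the edges and loops of N valid, so S_N is legal stable. For b ∈ B_+ ∩ B'_-:
-- if α_b = 1 then b_ℓ has a +-edge in S_N, which it prefers to its −-edge in S_0, against the optimality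
-- of S_0; if α_b = −1 then the S_0-edge (a_ℓ^-, b_r^+) blocks S_N, since a_ℓ prefers it by optimality
-- (it is not in S_N, as α_a = 1) and b_r sits in S_N on a +-edge, below every −-edge.

open import Defs
open import Data.Fin using (Fin)
open import Data.Bool using (Bool)
open import Data.Integer using (ℤ; +_)
open import Relation.Binary.PropositionalEquality using (_≡_)

open import Data.Bool using (true; false; _∧_; if_then_else_)
open import Data.Bool.Properties using (T-≡; ¬-not; ∧-zeroʳ)
open import Data.Empty using (⊥; ⊥-elim)
open import Data.Fin using (zero; suc)
open import Data.Fin.Properties using (_≟_; suc-injective; 0≢1+n)
open import Data.Integer as ℤ using (-[1+_])
import Data.Integer.Properties as ℤP
open import Algebra.Properties.CommutativeMonoid.Sum ℤP.+-0-commutativeMonoid using (sum; ∑-distrib-+; ∑-comm; sum-replicate-zero)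
open import Data.Maybe as Maybe using (Maybe; just; nothing; maybe′)
import Data.Maybe.Properties as MaybeP
open import Data.Nat as ℕ using (ℕ; zero; suc; z≤n; s≤s; _<ᵇ_)
import Data.Nat.Properties as ℕP
open import Data.Product using (Σ; _×_; _,_; proj₁; proj₂)
open import Data.Sum using (_⊎_; inj₁; inj₂)
import Data.Sum.Properties as SumP
open import Data.Unit using (tt)
open import Function.Bundles using (Equivalence)
open import Relation.Nullary using (¬_; Dec; yes; no; does; _×-dec_)
open import Relation.Nullary.Decidable using (dec-true)
open import Relation.Binary.Definitions using (DecidableEquality)
open import Relation.Binary.PropositionalEquality using (refl; sym; trans; cong; cong₂; subst; subst₂; _≢_; module ≡-Reasoning)

<ᵇ⇒< : ∀ m n → (m <ᵇ n) ≡ true → m ℕ.< n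
<ᵇ⇒< m n eq = ℕP.<ᵇ⇒< m n (Equivalence.from T-≡ eq)

<⇒<ᵇ : ∀ {m n} → m ℕ.< n → (m <ᵇ n) ≡ true
<⇒<ᵇ lt = Equivalence.to T-≡ (ℕP.<⇒<ᵇ lt)

≮⇒<ᵇ-false : ∀ m n → ¬ m ℕ.< n → (m <ᵇ n) ≡ false
≮⇒<ᵇ-false m n m≮n = ¬-not (λ eq → m≮n (<ᵇ⇒< m n eq))

<ᵇ-irrefl : ∀ n → (n <ᵇ n) ≡ false
<ᵇ-irrefl n = ≮⇒<ᵇ-false n n (ℕP.<-irrefl refl)

<ᵇ-asym : ∀ m n → (m <ᵇ n) ≡ true → (n <ᵇ m) ≡ false
<ᵇ-asym m n eq = ≮⇒<ᵇ-false n m (ℕP.<-asym (<ᵇ⇒< m n eq))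

false≢true : ∀ {b} → b ≡ false → b ≢ true
false≢true refl ()

countF-none : ∀ {n} (p : Fin n → Bool) → (∀ i → p i ≢ true) → countF p ≡ 0
countF-none {zero}  p none = refl
countF-none {suc n} p none with p zero in eq
... | true  = ⊥-elim (none zero eq)
... | false = countF-none (λ i → p (suc i)) (λ i → none (suc i))

countF-≥1 : ∀ {n} (p : Fin n → Bool) i → p i ≡ true → 1 ℕ.≤ countF p
countF-≥1 p zero    pi rewrite pi = s≤s z≤n
countF-≥1 p (suc i) pi = ℕP.≤-trans (countF-≥1 (λ j → p (suc j)) i pi) (ℕP.m≤n+m _ _)

countF-≥2 : ∀ {n} (p : Fin n → Bool) i j → i ≢ j → p i ≡ true → p j ≡ true → 2 ℕ.≤ countF p
countF-≥2 p zero    zero    i≢j _  _  = ⊥-elim (i≢j refl)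
countF-≥2 p zero    (suc j) _   pi pj rewrite pi = s≤s (countF-≥1 (λ k → p (suc k)) j pj)
countF-≥2 p (suc i) zero    _   pi pj rewrite pj = s≤s (countF-≥1 (λ k → p (suc k)) i pi)
countF-≥2 p (suc i) (suc j) i≢j pi pj =
  ℕP.≤-trans (countF-≥2 (λ k → p (suc k)) i j (λ eq → i≢j (cong suc eq)) pi pj) (ℕP.m≤n+m _ _)

countF-≤1 : ∀ {n} (p : Fin n → Bool) → (∀ i j → p i ≡ true → p j ≡ true → i ≡ j) → countF p ℕ.≤ 1
countF-≤1 {zero}  p unique = z≤n
countF-≤1 {suc n} p unique with p zero in eq
... | true rewrite countF-none (λ i → p (suc i)) (λ i pi → 0≢1+n (unique zero (suc i) eq pi)) = s≤s z≤n
... | false = countF-≤1 (λ i → p (suc i)) (λ i j pi pj → suc-injective (unique (suc i) (suc j) pi pj))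

sumℤ≡sum : ∀ {n} (f : Fin n → ℤ) → sumℤ f ≡ sum f
sumℤ≡sum {zero}  f = refl
sumℤ≡sum {suc n} f = cong (ℤ._+_ (f zero)) (sumℤ≡sum (λ i → f (suc i)))

sumℤ-distrib-+ : ∀ {n} (f g : Fin n → ℤ) → sumℤ (λ i → f i ℤ.+ g i) ≡ sumℤ f ℤ.+ sumℤ g
sumℤ-distrib-+ f g rewrite sumℤ≡sum (λ i → f i ℤ.+ g i) | sumℤ≡sum f | sumℤ≡sum g = ∑-distrib-+ f g

sumℤ-cong : ∀ {n} {f g : Fin n → ℤ} → (∀ i → f i ≡ g i) → sumℤ f ≡ sumℤ g
sumℤ-cong {zero}  f≗g = refl
sumℤ-cong {suc n} f≗g = cong₂ ℤ._+_ (f≗g zero) (sumℤ-cong (λ i → f≗g (suc i)))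

sumℤ-comm : ∀ {m n} (f : Fin m → Fin n → ℤ) →
            sumℤ (λ i → sumℤ (λ j → f i j)) ≡ sumℤ (λ j → sumℤ (λ i → f i j))
sumℤ-comm f = begin
  sumℤ (λ i → sumℤ (λ j → f i j)) ≡⟨ toSum (λ i j → f i j) ⟩
  sum (λ i → sum (λ j → f i j))   ≡⟨ ∑-comm f ⟩
  sum (λ j → sum (λ i → f i j))   ≡⟨ sym (toSum (λ j i → f i j)) ⟩
  sumℤ (λ j → sumℤ (λ i → f i j)) ∎
  where
  open ≡-Reasoning
  toSum : ∀ {m n} (g : Fin m → Fin n → ℤ) → sumℤ (λ i → sumℤ (g i)) ≡ sum (λ i → sum (g i))
  toSum {m} g = trans (sumℤ-cong (λ i → sumℤ≡sum (g i))) (sumℤ≡sum {m} (λ i → sum (g i)))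

sumℤ-zero : ∀ {n} (f : Fin n → ℤ) → (∀ i → f i ≡ + 0) → sumℤ f ≡ + 0
sumℤ-zero {n} f f≗0 = trans (sumℤ-cong f≗0) (trans (sumℤ≡sum {n} (λ _ → + 0)) (sum-replicate-zero n))

sumℤ-single : ∀ {n} (f : Fin n → ℤ) k → (∀ j → j ≢ k → f j ≡ + 0) → sumℤ f ≡ f k
sumℤ-single f zero    off-k =
  trans (cong (ℤ._+_ (f zero)) (sumℤ-zero (λ i → f (suc i)) (λ i → off-k (suc i) λ ()))) (ℤP.+-identityʳ _)
sumℤ-single f (suc k) off-k rewrite off-k zero (λ ()) =
  trans (ℤP.+-identityˡ _) (sumℤ-single (λ i → f (suc i)) k (λ j j≢k → off-k (suc j) (λ eq → j≢k (suc-injective eq))))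

+-nonneg-zero : ∀ {x y} → + 0 ℤ.≤ x → + 0 ℤ.≤ y → x ℤ.+ y ≡ + 0 → x ≡ + 0 × y ≡ + 0
+-nonneg-zero {+ m} {+ n} _ _ m+n≡0 =
  cong +_ (ℕP.m+n≡0⇒m≡0 m (ℤP.+-injective m+n≡0)) , cong +_ (ℕP.m+n≡0⇒n≡0 m (ℤP.+-injective m+n≡0))

sumℤ-nonneg : ∀ {n} (f : Fin n → ℤ) → (∀ i → + 0 ℤ.≤ f i) → + 0 ℤ.≤ sumℤ f
sumℤ-nonneg {zero}  f f≥0 = ℤ.+≤+ z≤n
sumℤ-nonneg {suc n} f f≥0 = ℤP.+-mono-≤ (f≥0 zero) (sumℤ-nonneg (λ i → f (suc i)) (λ i → f≥0 (suc i)))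

sumℤ-nonneg-zero : ∀ {n} (f : Fin n → ℤ) → (∀ i → + 0 ℤ.≤ f i) → sumℤ f ≡ + 0 → ∀ i → f i ≡ + 0
sumℤ-nonneg-zero f f≥0 Σ≡0 zero    = proj₁ (+-nonneg-zero (f≥0 zero) (sumℤ-nonneg _ (λ i → f≥0 (suc i))) Σ≡0)
sumℤ-nonneg-zero f f≥0 Σ≡0 (suc i) =
  sumℤ-nonneg-zero (λ j → f (suc j)) (λ j → f≥0 (suc j))
    (proj₂ (+-nonneg-zero (f≥0 zero) (sumℤ-nonneg _ (λ j → f≥0 (suc j))) Σ≡0)) i

argmin : ∀ {n} (P : Fin n → Bool) (r : Fin n → ℕ) →
         (∀ i → P i ≢ true) ⊎ Σ (Fin n) (λ i → P i ≡ true × (∀ j → P j ≡ true → r i ℕ.≤ r j))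
argmin {zero}  P r = inj₁ (λ ())
argmin {suc n} P r with P zero in P0 | argmin (λ i → P (suc i)) (λ i → r (suc i))
... | false | inj₁ none = inj₁ λ { zero → false≢true P0 ; (suc j) → none j }
... | false | inj₂ (i , Pi , min) = inj₂ (suc i , Pi , λ { zero P0′ → ⊥-elim (false≢true P0 P0′) ; (suc j) → min j })
... | true  | inj₁ none = inj₂ (zero , P0 , λ { zero _ → ℕP.≤-refl ; (suc j) Pj → ⊥-elim (none j Pj) })
... | true  | inj₂ (i , Pi , min) with r zero ℕP.≤? r (suc i)
...   | yes r0≤ = inj₂ (zero , P0 , λ { zero _ → ℕP.≤-refl ; (suc j) Pj → ℕP.≤-trans r0≤ (min j Pj) })
...   | no r0≰ = inj₂ (suc i , Pi , λ { zero _ → ℕP.<⇒≤ (ℕP.≰⇒> r0≰) ; (suc j) → min j })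

dropPartner : ∀ {m} → Fin m → Maybe (Fin m) → Maybe (Fin m)
dropPartner b nothing  = nothing
dropPartner b (just y) with y ≟ b
... | yes _ = nothing
... | no _  = just y

setPartner : ∀ {n m} → Fin n → Fin m → (Fin n → Maybe (Fin m)) → Fin n → Maybe (Fin m)
setPartner a b p x with x ≟ a
... | yes _ = just b
... | no _  = dropPartner b (p x)

dropPartner-other : ∀ {m} (b : Fin m) q → q ≢ just b → dropPartner b q ≡ q
dropPartner-other b nothing  _ = refl
dropPartner-other b (just y) q≢b with y ≟ b
... | yes refl = ⊥-elim (q≢b refl)
... | no _     = refl

dropPartner-just : ∀ {m} (b : Fin m) q {y} → dropPartner b q ≡ just y → q ≡ just y × y ≢ b
dropPartner-just b (just z) eq with z ≟ b
dropPartner-just b (just z) ()   | yes _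
dropPartner-just b (just z) refl | no z≢b = refl , z≢b

setPartner-self : ∀ {n m} (a : Fin n) (b : Fin m) p → setPartner a b p a ≡ just b
setPartner-self a b p with a ≟ a
... | yes _ = refl
... | no a≢a = ⊥-elim (a≢a refl)

setPartner-other : ∀ {n m} (a : Fin n) (b : Fin m) p x → x ≢ a → p x ≢ just b → setPartner a b p x ≡ p x
setPartner-other a b p x x≢a px≢b with x ≟ a
... | yes x≡a = ⊥-elim (x≢a x≡a)
... | no _    = dropPartner-other b (p x) px≢b

setPartner-just : ∀ {n m} (a : Fin n) (b : Fin m) p x {y} → setPartner a b p x ≡ just y →
                  (x ≡ a × y ≡ b) ⊎ (x ≢ a × p x ≡ just y × y ≢ b)
setPartner-just a b p x eq with x ≟ a
setPartner-just a b p x refl | yes x≡a = inj₁ (x≡a , refl)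
... | no x≢a = inj₂ (x≢a , dropPartner-just b (p x) eq)

just≢nothing : ∀ {X : Set} {m : Maybe X} {x} → m ≡ just x → m ≢ nothing
just≢nothing refl ()

onlyIf : ∀ {P : Set} → Dec P → ℤ → ℤ
onlyIf (yes _) x = x
onlyIf (no _)  _ = + 0

onlyIf-yes : ∀ {P : Set} (d : Dec P) x → P → onlyIf d x ≡ x
onlyIf-yes (yes _) x _ = refl
onlyIf-yes (no ¬p) x p = ⊥-elim (¬p p)

onlyIf-no : ∀ {P : Set} (d : Dec P) x → ¬ P → onlyIf d x ≡ + 0
onlyIf-no (yes p) x ¬p = ⊥-elim (¬p p)
onlyIf-no (no _)  x _  = refl

-- wt N a b unfolds to wtShape applied to: a prefers b, b prefers a, a prefers its partner, b prefers its partner.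
wtShape : Bool → Bool → Bool → Bool → ℤ
wtShape p q p′ q′ = if p ∧ q then + 2 else if p′ ∧ q′ then -[1+ 1 ] else + 0

wtShape-nonneg : ∀ p q p′ q′ → p′ ∧ q′ ≡ false → + 0 ℤ.≤ wtShape p q p′ q′
wtShape-nonneg p q p′ q′ ¬both with p ∧ q
... | true  = ℤ.+≤+ z≤n
... | false rewrite ¬both = ℤ.+≤+ z≤n

wtShape-two : ∀ p q p′ q′ → p ≡ true → q ≡ true → wtShape p q p′ q′ ≡ + 2
wtShape-two true true _ _ _ _ = refl

signOf : ℤ → Sign
signOf (+ 1) = plus
signOf _     = minus

signOf-plus : ∀ z → signOf z ≡ plus → z ≡ + 1
signOf-plus (+ 1)          _  = refl
signOf-plus (+ 0)          ()
signOf-plus (+ suc (suc _)) ()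
signOf-plus -[1+ _ ]       ()

signOf-minus : ∀ z → signOf z ≡ minus → z ≢ + 1
signOf-minus .(+ 1) () refl

_≟ˢ_ : DecidableEquality Sign
plus  ≟ˢ plus  = yes refl
minus ≟ˢ minus = yes refl
plus  ≟ˢ minus = no λ ()
minus ≟ˢ plus  = no λ ()

decided : ∀ {P : Set} (d : Dec P) → does d ≡ true → P
decided (yes p) _ = p

module _ (I : Instance) where
  open Instance I
  open Theory I

  betterA-irrefl : ∀ a p → betterA a p p ≡ false
  betterA-irrefl a (just b) = <ᵇ-irrefl (rankA a b)
  betterA-irrefl a nothing  = refl

  betterA-asym : ∀ a p q → betterA a p q ≡ true → betterA a q p ≡ false
  betterA-asym a (just b) (just b′) = <ᵇ-asym (rankA a b) (rankA a b′)
  betterA-asym a (just b) nothing   _ = refl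

  betterB-asym : ∀ b p q → betterB b p q ≡ true → betterB b q p ≡ false
  betterB-asym b (just a) (just a′) = <ᵇ-asym (rankB b a) (rankB b a′)
  betterB-asym b (just a) nothing   _ = refl

  pA-injective : ∀ (M : Matching) x y {b} → pA M x ≡ just b → pA M y ≡ just b → x ≡ y
  pA-injective M x y {b} px py = MaybeP.just-injective (trans (sym (proj₂ (pA-ok M x b px))) (proj₂ (pA-ok M y b py)))

  -- Match a with b; their former partners become unmatched.
  assign : (M : Matching) (a : Fin nA) (b : Fin nB) → E a b ≡ true → Matching
  assign M a b Eab = record
    { pA = setPartner a b (pA M)
    ; pB = setPartner b a (pB M)
    ; pA-ok = okA
    ; pB-ok = okB
    }
    where
    okA : ∀ x y → setPartner a b (pA M) x ≡ just y → E x y ≡ true × setPartner b a (pB M) y ≡ just x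
    okA x y eq with setPartner-just a b (pA M) x eq
    ... | inj₁ (refl , refl) = Eab , setPartner-self b a (pB M)
    ... | inj₂ (x≢a , px , y≢b) =
      proj₁ (pA-ok M x y px) ,
      trans (setPartner-other b a (pB M) y y≢b
               (λ py → x≢a (MaybeP.just-injective (trans (sym (proj₂ (pA-ok M x y px))) py))))
            (proj₂ (pA-ok M x y px))
    okB : ∀ y x → setPartner b a (pB M) y ≡ just x → setPartner a b (pA M) x ≡ just y
    okB y x eq with setPartner-just b a (pB M) y eq
    ... | inj₁ (refl , refl) = setPartner-self a b (pA M)
    ... | inj₂ (y≢b , py , x≢a) =
      trans (setPartner-other a b (pA M) x x≢a
               (λ px → y≢b (MaybeP.just-injective (trans (sym (pB-ok M y x py)) px))))
            (pB-ok M y x py)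

  assign-self : ∀ M a b Eab → pA (assign M a b Eab) a ≡ just b
  assign-self M a b Eab = setPartner-self a b (pA M)

  assign-other : ∀ M a b Eab x → x ≢ a → pA M x ≢ just b → pA (assign M a b Eab) x ≡ pA M x
  assign-other M a b Eab = setPartner-other a b (pA M)

  topChoice : ∀ a b → E a b ≡ true → Σ (Fin nB) (IsF a)
  topChoice a b Eab with argmin (E a) (rankA a)
  ... | inj₁ none = ⊥-elim (none b Eab)
  ... | inj₂ (c , Eac , min) = c , Eac , min

  IsF-rank-< : ∀ a c b → IsF a c → E a b ≡ true → c ≢ b → rankA a c ℕ.< rankA a b
  IsF-rank-< a c b (Eac , min) Eab c≢b = ℕP.≤∧≢⇒< (min b Eab) (λ eq → c≢b (strictA a c b Eac Eab eq))

  module APopularFacts (N : Matching) (apop : APopular N) where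

    Gains Loses : Matching → Fin nA → Set
    Gains N′ x = betterA x (pA N′ x) (pA N x) ≡ true
    Loses N′ x = betterA x (pA N x) (pA N′ x) ≡ true

    unchanged-no-loss : ∀ N′ x → pA N′ x ≡ pA N x → ¬ Loses N′ x
    unchanged-no-loss N′ x same lose =
      false≢true (trans (cong (betterA x (pA N x)) same) (betterA-irrefl x (pA N x))) lose

    gain-no-loss : ∀ N′ x → Gains N′ x → ¬ Loses N′ x
    gain-no-loss N′ x gain = false≢true (betterA-asym x (pA N′ x) (pA N x) gain)

    no-lone-gain : ∀ N′ g → Gains N′ g → (∀ x → x ≢ g → pA N′ x ≡ pA N x) → ⊥
    no-lone-gain N′ g gain rest = ℕP.<-irrefl refl (begin-strict
      0         <⟨ countF-≥1 _ g gain ⟩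
      φA N′ N   ≤⟨ apop N′ ⟩
      φA N N′   ≡⟨ countF-none _ noLoser ⟩
      0         ∎)
      where
      open ℕP.≤-Reasoning
      noLoser : ∀ x → ¬ Loses N′ x
      noLoser x with x ≟ g
      ... | yes refl = gain-no-loss N′ x gain
      ... | no x≢g   = unchanged-no-loss N′ x (rest x x≢g)

    no-double-gain : ∀ N′ c g₁ g₂ → g₁ ≢ g₂ → Gains N′ g₁ → Gains N′ g₂ →
                     (∀ x → x ≢ g₁ → x ≢ g₂ → pA N x ≢ just c → pA N′ x ≡ pA N x) → ⊥
    no-double-gain N′ c g₁ g₂ g₁≢g₂ gain₁ gain₂ rest =
      ℕP.<-irrefl refl (begin-strict
        1         <⟨ countF-≥2 _ g₁ g₂ g₁≢g₂ gain₁ gain₂ ⟩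
        φA N′ N   ≤⟨ apop N′ ⟩
        φA N N′   ≤⟨ countF-≤1 _ (λ x y lx ly → pA-injective N x y (loser-holds x lx) (loser-holds y ly)) ⟩
        1         ∎)
      where
      open ℕP.≤-Reasoning
      loser-holds : ∀ x → Loses N′ x → pA N x ≡ just c
      loser-holds x lose with x ≟ g₁ | x ≟ g₂ | MaybeP.≡-dec _≟_ (pA N x) (just c)
      ... | yes refl | _        | _         = ⊥-elim (gain-no-loss N′ x gain₁ lose)
      ... | no _     | yes refl | _         = ⊥-elim (gain-no-loss N′ x gain₂ lose)
      ... | no _     | no _     | yes holds = holds
      ... | no x≢g₁  | no x≢g₂  | no ¬holds = ⊥-elim (unchanged-no-loss N′ x (rest x x≢g₁ x≢g₂ ¬holds) lose)

    top-choice-gain : ∀ a b → IsF a b → pA N a ≢ just b → betterA a (just b) (pA N a) ≡ true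
    top-choice-gain a b (Eab , top) a↛b with pA N a in pa
    ... | nothing = refl
    ... | just b′ =
      <⇒<ᵇ (ℕP.≤∧≢⇒< (top b′ Eab′) (λ eq → a↛b (cong just (sym (strictA a b b′ Eab Eab′ eq)))))
      where
      Eab′ : E a b′ ≡ true
      Eab′ = proj₁ (pA-ok N a b′ pa)

    unmatched⇒NotF : ∀ b → pB N b ≡ nothing → NotF b
    unmatched⇒NotF b b-free a fab@(Eab , _) =
      no-lone-gain N′ a (subst (λ p → betterA a p (pA N a) ≡ true) (sym (assign-self N a b Eab))
                               (top-choice-gain a b fab (nobody-holds a)))
                    (λ x x≢a → assign-other N a b Eab x x≢a (nobody-holds x))
      where
      N′ : Matching
      N′ = assign N a b Eab
      nobody-holds : ∀ x → pA N x ≢ just b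
      nobody-holds x px = just≢nothing (proj₂ (pA-ok N x b px)) b-free

    -- If b is free, a takes it; otherwise a takes b and b's partner a₃ moves to f(a₃), which is not b.
    no-gain-at-NotF : ∀ a b → E a b ≡ true → NotF b → betterA a (just b) (pA N a) ≢ true
    no-gain-at-NotF a b Eab notF gain with pB N b in pb
    ... | nothing = no-lone-gain N₁ a gain₁ rest
      where
      N₁ : Matching
      N₁ = assign N a b Eab
      gain₁ : Gains N₁ a
      gain₁ = subst (λ p → betterA a p (pA N a) ≡ true) (sym (assign-self N a b Eab)) gain
      rest : ∀ x → x ≢ a → pA N₁ x ≡ pA N x
      rest x x≢a = assign-other N a b Eab x x≢a (λ px → just≢nothing (proj₂ (pA-ok N x b px)) pb)
    ... | just a₃ = no-double-gain N₂ d a a₃ a≢a₃ gain-a gain-a₃ rest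
      where
      pa₃ : pA N a₃ ≡ just b
      pa₃ = pB-ok N b a₃ pb
      Ea₃b : E a₃ b ≡ true
      Ea₃b = proj₁ (pA-ok N a₃ b pa₃)
      a≢a₃ : a ≢ a₃
      a≢a₃ refl = false≢true (trans (cong (betterA a (just b)) pa₃) (betterA-irrefl a (just b))) gain
      d : Fin nB
      d = proj₁ (topChoice a₃ b Ea₃b)
      fd : IsF a₃ d
      fd = proj₂ (topChoice a₃ b Ea₃b)
      d≢b : d ≢ b
      d≢b d≡b = notF a₃ (subst (IsF a₃) d≡b fd)
      N₁ N₂ : Matching
      N₁ = assign N a b Eab
      N₂ = assign N₁ a₃ d (proj₁ fd)
      p₂a : pA N₂ a ≡ just b
      p₂a = trans (assign-other N₁ a₃ d (proj₁ fd) a a≢a₃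
                     (λ eq → d≢b (sym (MaybeP.just-injective (trans (sym (assign-self N a b Eab)) eq)))))
                  (assign-self N a b Eab)
      gain-a : Gains N₂ a
      gain-a = subst (λ p → betterA a p (pA N a) ≡ true) (sym p₂a) gain
      gain-a₃ : Gains N₂ a₃
      gain-a₃ = trans (cong₂ (betterA a₃) (assign-self N₁ a₃ d (proj₁ fd)) pa₃)
                      (<⇒<ᵇ (IsF-rank-< a₃ d b fd Ea₃b d≢b))
      rest : ∀ x → x ≢ a → x ≢ a₃ → pA N x ≢ just d → pA N₂ x ≡ pA N x
      rest x x≢a x≢a₃ x↛d =
        trans (assign-other N₁ a₃ d (proj₁ fd) x x≢a₃ (λ eq → x↛d (trans (sym p₁x) eq))) p₁x
        where
        p₁x : pA N₁ x ≡ pA N x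
        p₁x = assign-other N a b Eab x x≢a (λ px → x≢a₃ (pA-injective N x a₃ px pa₃))

    -- a swaps b for f(a) = c, and the other agent a₁ with f(a₁) = b takes b.
    matched-f-unique : ∀ a b a₁ c → pA N a ≡ just b → IsF a₁ b → a₁ ≢ a → IsF a c → c ≢ b → ⊥
    matched-f-unique a b a₁ c pa fb a₁≢a fc c≢b =
      no-double-gain N₂ c a a₁ (λ eq → a₁≢a (sym eq)) gain-a gain-a₁ rest
      where
      Eab : E a b ≡ true
      Eab = proj₁ (pA-ok N a b pa)
      N₁ N₂ : Matching
      N₁ = assign N a c (proj₁ fc)
      N₂ = assign N₁ a₁ b (proj₁ fb)
      p₂a : pA N₂ a ≡ just c
      p₂a = trans (assign-other N₁ a₁ b (proj₁ fb) a (λ eq → a₁≢a (sym eq))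
                     (λ eq → c≢b (MaybeP.just-injective (trans (sym (assign-self N a c (proj₁ fc))) eq))))
                  (assign-self N a c (proj₁ fc))
      gain-a : Gains N₂ a
      gain-a = trans (cong₂ (betterA a) p₂a pa) (<⇒<ᵇ (IsF-rank-< a c b fc Eab c≢b))
      only-a-holds-b : ∀ x → x ≢ a → pA N x ≢ just b
      only-a-holds-b x x≢a px = x≢a (pA-injective N x a px pa)
      gain-a₁ : Gains N₂ a₁
      gain-a₁ = subst (λ p → betterA a₁ p (pA N a₁) ≡ true) (sym (assign-self N₁ a₁ b (proj₁ fb)))
                      (top-choice-gain a₁ b fb (only-a-holds-b a₁ a₁≢a))
      rest : ∀ x → x ≢ a → x ≢ a₁ → pA N x ≢ just c → pA N₂ x ≡ pA N x
      rest x x≢a x≢a₁ x↛c =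
        trans (assign-other N₁ a₁ b (proj₁ fb) x x≢a₁ (λ eq → only-a-holds-b x x≢a (trans (sym p₁x) eq))) p₁x
        where
        p₁x : pA N₁ x ≡ pA N x
        p₁x = assign-other N a c (proj₁ fc) x x≢a x↛c

    matched⇒ValidEdge : ∀ a b → pA N a ≡ just b → ValidEdge a b
    matched⇒ValidEdge a b pa = choose (topChoice a b Eab)
      where
      Eab : E a b ≡ true
      Eab = proj₁ (pA-ok N a b pa)
      choose : Σ (Fin nB) (IsF a) → ValidEdge a b
      choose (c , fc) with c ≟ b
      ... | yes refl = inj₁ fc
      ... | no c≢b   = inj₂ (Eab , notF , best)
        where
        notF : NotF b
        notF a₁ fb with a₁ ≟ a
        ... | yes refl = c≢b (strictA a c b (proj₁ fc) Eab (ℕP.≤-antisym (proj₂ fc b Eab) (proj₂ fb c (proj₁ fc))))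
        ... | no a₁≢a  = matched-f-unique a b a₁ c pa fb a₁≢a fc c≢b
        best : ∀ b′ → E a b′ ≡ true → NotF b′ → rankA a b ℕ.≤ rankA a b′
        best b′ Eab′ notF′ with rankA a b ℕP.≤? rankA a b′
        ... | yes le = le
        ... | no nle = ⊥-elim (no-gain-at-NotF a b′ Eab′ notF′
                                 (trans (cong (betterA a (just b′)) pa) (<⇒<ᵇ (ℕP.≰⇒> nle))))

    unmatched⇒ValidLoopA : ∀ a → pA N a ≡ nothing → ValidLoopA a
    unmatched⇒ValidLoopA a pa b Eab notF = no-gain-at-NotF a b Eab notF (cong (betterA a (just b)) pa)

  module WitnessFacts (N : Matching) (αA : Fin nA → ℤ) (αB : Fin nB → ℤ) (wit : Witness N αA αB) where

    private
      ΣαA+ΣαB≡0 : sumℤ αA ℤ.+ sumℤ αB ≡ + 0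
      ΣαA+ΣαB≡0 = proj₁ (proj₂ (proj₂ wit))
      edge-covered : ∀ a b → E a b ≡ true → wt N a b ℤ.≤ αA a ℤ.+ αB b
      edge-covered = proj₁ (proj₂ (proj₂ (proj₂ wit)))
      loopA-covered : ∀ a → wtLoopA N a ℤ.≤ αA a
      loopA-covered = proj₁ (proj₂ (proj₂ (proj₂ (proj₂ wit))))
      loopB-covered : ∀ b → wtLoopB N b ℤ.≤ αB b
      loopB-covered = proj₂ (proj₂ (proj₂ (proj₂ (proj₂ wit))))

    αA-In01 : ∀ a → In01 (αA a)
    αA-In01 = proj₁ wit

    αB-In01 : ∀ b → In01 (αB b)
    αB-In01 = proj₁ (proj₂ wit)

    private
      module Flags (a : Fin nA) (b : Fin nB) where
        aPrefers aKeeps bPrefers bKeeps : Bool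
        aPrefers = betterA a (just b) (pA N a)
        aKeeps   = betterA a (pA N a) (just b)
        bPrefers = betterB b (just a) (pB N b)
        bKeeps   = betterB b (pB N b) (just a)

    wt-nonneg-A : ∀ a b → E a b ≡ true → betterA a (just b) (pA N a) ≡ true → + 0 ℤ.≤ αA a ℤ.+ αB b
    wt-nonneg-A a b Eab gain = ℤP.≤-trans
      (wtShape-nonneg aPrefers bPrefers aKeeps bKeeps (cong (_∧ bKeeps) (betterA-asym a (just b) (pA N a) gain)))
      (edge-covered a b Eab)
      where open Flags a b

    wt-nonneg-B : ∀ a b → E a b ≡ true → betterB b (just a) (pB N b) ≡ true → + 0 ℤ.≤ αA a ℤ.+ αB b
    wt-nonneg-B a b Eab gain = ℤP.≤-trans
      (wtShape-nonneg aPrefers bPrefers aKeeps bKeeps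
        (trans (cong (aKeeps ∧_) (betterB-asym b (just a) (pB N b) gain)) (∧-zeroʳ aKeeps)))
      (edge-covered a b Eab)
      where open Flags a b

    wt-two : ∀ a b → E a b ≡ true → betterA a (just b) (pA N a) ≡ true → betterB b (just a) (pB N b) ≡ true →
             + 2 ℤ.≤ αA a ℤ.+ αB b
    wt-two a b Eab gainA gainB =
      subst (ℤ._≤ αA a ℤ.+ αB b) (wtShape-two aPrefers bPrefers aKeeps bKeeps gainA gainB) (edge-covered a b Eab)
      where open Flags a b

    wtLoopA-unmatched : ∀ a → pA N a ≡ nothing → wtLoopA N a ≡ + 0
    wtLoopA-unmatched a pa rewrite pa = refl

    wtLoopB-unmatched : ∀ b → pB N b ≡ nothing → wtLoopB N b ≡ + 0
    wtLoopB-unmatched b pb rewrite pb = refl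

    slackA : Fin nA → ℤ
    slackA a = αA a ℤ.+ maybe′ αB (+ 0) (pA N a)

    slackB : Fin nB → ℤ
    slackB b = maybe′ (λ _ → + 0) (αB b) (pB N b)

    slackA-nonneg : ∀ a → + 0 ℤ.≤ slackA a
    slackA-nonneg a with pA N a in pa
    ... | just b = ℤP.≤-trans
      (wtShape-nonneg aPrefers bPrefers aKeeps bKeeps
        (cong (_∧ bKeeps) (trans (cong (λ p → betterA a p (just b)) pa) (betterA-irrefl a (just b)))))
      (edge-covered a b (proj₁ (pA-ok N a b pa)))
      where open Flags a b
    ... | nothing = subst₂ ℤ._≤_ (wtLoopA-unmatched a pa) (sym (ℤP.+-identityʳ (αA a))) (loopA-covered a)

    slackB-nonneg : ∀ b → + 0 ℤ.≤ slackB b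
    slackB-nonneg b with pB N b in pb
    ... | just _  = ℤ.+≤+ z≤n
    ... | nothing = subst (ℤ._≤ αB b) (wtLoopB-unmatched b pb) (loopB-covered b)

    -- Both sides equal ∑_a ∑_b [N(a) = b] αB b.
    sum-over-partners : sumℤ (λ a → maybe′ αB (+ 0) (pA N a)) ≡ sumℤ (λ b → maybe′ (λ _ → αB b) (+ 0) (pB N b))
    sum-over-partners = begin
      sumℤ (λ a → maybe′ αB (+ 0) (pA N a))             ≡⟨ sumℤ-cong (λ a → sym (row a (pA N a) refl)) ⟩
      sumℤ (λ a → sumℤ (λ b → held a b))                ≡⟨ sumℤ-comm held ⟩
      sumℤ (λ b → sumℤ (λ a → held a b))                ≡⟨ sumℤ-cong column ⟩
      sumℤ (λ b → maybe′ (λ _ → αB b) (+ 0) (pB N b))   ∎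
      where
      open ≡-Reasoning
      held : Fin nA → Fin nB → ℤ
      held a b = onlyIf (MaybeP.≡-dec _≟_ (pA N a) (just b)) (αB b)
      row : ∀ a p → pA N a ≡ p → sumℤ (λ b → held a b) ≡ maybe′ αB (+ 0) p
      row a nothing  pa = sumℤ-zero _ (λ b → onlyIf-no _ (αB b) (λ pab → just≢nothing pab pa))
      row a (just c) pa =
        trans (sumℤ-single _ c (λ b b≢c → onlyIf-no _ (αB b) (λ pab → b≢c (MaybeP.just-injective (trans (sym pab) pa)))))
                                (onlyIf-yes _ (αB c) pa)
      column : ∀ b → sumℤ (λ a → held a b) ≡ maybe′ (λ _ → αB b) (+ 0) (pB N b)
      column b with pB N b in pb
      ... | nothing = sumℤ-zero _ (λ a → onlyIf-no _ (αB b) (λ pab → just≢nothing (proj₂ (pA-ok N a b pab)) pb))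
      ... | just c  = trans (sumℤ-single _ c (λ a a≢c → onlyIf-no _ (αB b)
                                 (λ pab → a≢c (MaybeP.just-injective (trans (sym (proj₂ (pA-ok N a b pab))) pb)))))
                            (onlyIf-yes _ (αB b) (pB-ok N b c pb))

    αB≡matched+slack : ∀ b → maybe′ (λ _ → αB b) (+ 0) (pB N b) ℤ.+ slackB b ≡ αB b
    αB≡matched+slack b with pB N b
    ... | just _  = ℤP.+-identityʳ (αB b)
    ... | nothing = ℤP.+-identityˡ (αB b)

    slack-total : sumℤ slackA ℤ.+ sumℤ slackB ≡ + 0
    slack-total = begin
      sumℤ slackA ℤ.+ sumℤ slackB
        ≡⟨ cong (ℤ._+ sumℤ slackB) (sumℤ-distrib-+ αA _) ⟩
      (sumℤ αA ℤ.+ sumℤ matchedA) ℤ.+ sumℤ slackB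
        ≡⟨ ℤP.+-assoc (sumℤ αA) _ _ ⟩
      sumℤ αA ℤ.+ (sumℤ matchedA ℤ.+ sumℤ slackB)
        ≡⟨ cong (λ s → sumℤ αA ℤ.+ (s ℤ.+ sumℤ slackB)) sum-over-partners ⟩
      sumℤ αA ℤ.+ (sumℤ matchedB ℤ.+ sumℤ slackB)
        ≡⟨ cong (ℤ._+_ (sumℤ αA)) (sym (sumℤ-distrib-+ matchedB slackB)) ⟩
      sumℤ αA ℤ.+ sumℤ (λ b → matchedB b ℤ.+ slackB b)
        ≡⟨ cong (ℤ._+_ (sumℤ αA)) (sumℤ-cong αB≡matched+slack) ⟩
      sumℤ αA ℤ.+ sumℤ αB
        ≡⟨ ΣαA+ΣαB≡0 ⟩
      + 0 ∎
      where
      open ≡-Reasoning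
      matchedA : Fin nA → ℤ
      matchedA a = maybe′ αB (+ 0) (pA N a)
      matchedB : Fin nB → ℤ
      matchedB b = maybe′ (λ _ → αB b) (+ 0) (pB N b)

    private
      slacks-zero : sumℤ slackA ≡ + 0 × sumℤ slackB ≡ + 0
      slacks-zero = +-nonneg-zero (sumℤ-nonneg slackA slackA-nonneg) (sumℤ-nonneg slackB slackB-nonneg) slack-total

    slackA-zero : ∀ a → slackA a ≡ + 0
    slackA-zero = sumℤ-nonneg-zero slackA slackA-nonneg (proj₁ slacks-zero)

    slackB-zero : ∀ b → slackB b ≡ + 0
    slackB-zero = sumℤ-nonneg-zero slackB slackB-nonneg (proj₂ slacks-zero)

    matched⇒α-sum-zero : ∀ a b → pA N a ≡ just b → αA a ℤ.+ αB b ≡ + 0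
    matched⇒α-sum-zero a b pa = trans (cong (λ p → αA a ℤ.+ maybe′ αB (+ 0) p) (sym pa)) (slackA-zero a)

    unmatchedA⇒α-zero : ∀ a → pA N a ≡ nothing → αA a ≡ + 0
    unmatchedA⇒α-zero a pa =
      trans (sym (ℤP.+-identityʳ (αA a))) (trans (cong (λ p → αA a ℤ.+ maybe′ αB (+ 0) p) (sym pa)) (slackA-zero a))

    unmatchedB⇒α-zero : ∀ b → pB N b ≡ nothing → αB b ≡ + 0
    unmatchedB⇒α-zero b pb = trans (cong (maybe′ (λ _ → + 0) (αB b)) (sym pb)) (slackB-zero b)

  prefL-irrefl : ∀ e → ¬ prefL e e
  prefL-irrefl e (inj₁ lt)      = ℕP.<-irrefl refl lt
  prefL-irrefl e (inj₂ (_ , lt)) = ℕP.<-irrefl refl lt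

  prefL-self-nbr : ∀ u x v s → ¬ prefL (self u) (nbr x v s)
  prefL-self-nbr u x v plus  (inj₁ ())
  prefL-self-nbr u x v plus  (inj₂ (() , _))
  prefL-self-nbr u x v minus (inj₁ (s≤s ()))
  prefL-self-nbr u x v minus (inj₂ (() , _))

  prefL-plus : ∀ x v y s → prefL (nbr x v plus) (nbr x y s) → s ≡ minus ⊎ rankV x v ℕ.< rankV x y
  prefL-plus x v y plus  (inj₁ ())
  prefL-plus x v y plus  (inj₂ (_ , lt)) = inj₂ lt
  prefL-plus x v y minus _               = inj₁ refl

  prefL-minus : ∀ x v y s → prefL (nbr x v minus) (nbr x y s) → s ≡ minus × rankV x v ℕ.< rankV x y
  prefL-minus x v y plus  (inj₁ ())
  prefL-minus x v y plus  (inj₂ (() , _))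
  prefL-minus x v y minus (inj₁ lt)       = ⊥-elim (ℕP.<-irrefl refl lt)
  prefL-minus x v y minus (inj₂ (_ , lt)) = refl , lt

  prefR-plus : ∀ x v w s → prefR (nbr x v plus) (nbr w v s) → s ≡ plus × rankV v x ℕ.< rankV v w
  prefR-plus x v w plus  (inj₁ (s≤s (s≤s ())))
  prefR-plus x v w plus  (inj₂ (_ , lt)) = refl , lt
  prefR-plus x v w minus (inj₁ ())
  prefR-plus x v w minus (inj₂ (() , _))

  prefR-plus-self : ∀ x v → ¬ prefR (nbr x v plus) (self v)
  prefR-plus-self x v (inj₁ (s≤s ()))
  prefR-plus-self x v (inj₂ (() , _))

  prefR-minus : ∀ x v w s → prefR (nbr x v minus) (nbr w v s) → s ≡ plus ⊎ rankV v x ℕ.< rankV v w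
  prefR-minus x v w plus  _               = inj₁ refl
  prefR-minus x v w minus (inj₁ ())
  prefR-minus x v w minus (inj₂ (_ , lt)) = inj₂ lt

  In01-2≤x+y⇒x≡y≡1 : ∀ {x y} → In01 x → In01 y → + 2 ℤ.≤ x ℤ.+ y → x ≡ + 1 × y ≡ + 1
  In01-2≤x+y⇒x≡y≡1 (inj₂ (inj₁ refl)) (inj₂ (inj₁ refl)) _  = refl , refl
  In01-2≤x+y⇒x≡y≡1 (inj₁ refl)        (inj₁ refl)        (ℤ.+≤+ ())
  In01-2≤x+y⇒x≡y≡1 (inj₁ refl)        (inj₂ (inj₁ refl)) (ℤ.+≤+ (s≤s ()))
  In01-2≤x+y⇒x≡y≡1 (inj₁ refl)        (inj₂ (inj₂ refl)) ()
  In01-2≤x+y⇒x≡y≡1 (inj₂ (inj₁ refl)) (inj₁ refl)        (ℤ.+≤+ (s≤s ()))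
  In01-2≤x+y⇒x≡y≡1 (inj₂ (inj₁ refl)) (inj₂ (inj₂ refl)) (ℤ.+≤+ ())
  In01-2≤x+y⇒x≡y≡1 (inj₂ (inj₂ refl)) (inj₁ refl)        ()
  In01-2≤x+y⇒x≡y≡1 (inj₂ (inj₂ refl)) (inj₂ (inj₁ refl)) (ℤ.+≤+ ())
  In01-2≤x+y⇒x≡y≡1 (inj₂ (inj₂ refl)) (inj₂ (inj₂ refl)) ()

  In01-0≤x-1⇒x≡1 : ∀ {x} → In01 x → + 0 ℤ.≤ x ℤ.+ -[1+ 0 ] → x ≡ + 1
  In01-0≤x-1⇒x≡1 (inj₂ (inj₁ refl)) _ = refl
  In01-0≤x-1⇒x≡1 (inj₁ refl)        ()
  In01-0≤x-1⇒x≡1 (inj₂ (inj₂ refl)) ()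

  In01-1+y≡0⇒y≡-1 : ∀ {y} → In01 y → + 1 ℤ.+ y ≡ + 0 → y ≡ -[1+ 0 ]
  In01-1+y≡0⇒y≡-1 (inj₂ (inj₂ refl)) _ = refl
  In01-1+y≡0⇒y≡-1 (inj₁ refl)        ()
  In01-1+y≡0⇒y≡-1 (inj₂ (inj₁ refl)) ()

  module ImageInH (N : Matching) (αA : Fin nA → ℤ) (αB : Fin nB → ℤ) (wit : Witness N αA αB) where
    open WitnessFacts N αA αB wit

    αV : VG → ℤ
    αV (inj₁ a) = αA a
    αV (inj₂ b) = αB b

    αV-In01 : ∀ u → In01 (αV u)
    αV-In01 (inj₁ a) = αA-In01 a
    αV-In01 (inj₂ b) = αB-In01 b

    partner : VG → Maybe VG
    partner (inj₁ a) = Maybe.map inj₂ (pA N a)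
    partner (inj₂ b) = Maybe.map inj₁ (pB N b)

    data Partners : VG → VG → Set where
      a→b : ∀ {a b} → pA N a ≡ just b → Partners (inj₁ a) (inj₂ b)
      b→a : ∀ {a b} → pB N b ≡ just a → Partners (inj₂ b) (inj₁ a)

    partners : ∀ x v → partner x ≡ just v → Partners x v
    partners (inj₁ a) v eq with pA N a in pa
    partners (inj₁ a) v refl | just b = a→b pa
    partners (inj₂ b) v eq with pB N b in pb
    partners (inj₂ b) v refl | just a = b→a pb

    partner-sym : ∀ x v → partner x ≡ just v → partner v ≡ just x
    partner-sym x v eq with partners x v eq
    ... | a→b {a} {b} pa = cong (Maybe.map inj₁) (proj₂ (pA-ok N a b pa))
    ... | b→a {a} {b} pb = cong (Maybe.map inj₂) (pB-ok N b a pb)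

    partner-Adj : ∀ x v → partner x ≡ just v → Adj x v
    partner-Adj x v eq with partners x v eq
    ... | a→b {a} {b} pa = proj₁ (pA-ok N a b pa)
    ... | b→a {a} {b} pb = proj₁ (pA-ok N a b (pB-ok N b a pb))

    partner-α-sum-zero : ∀ x v → partner x ≡ just v → αV x ℤ.+ αV v ≡ + 0
    partner-α-sum-zero x v eq with partners x v eq
    ... | a→b {a} {b} pa = matched⇒α-sum-zero a b pa
    ... | b→a {a} {b} pb = trans (ℤP.+-comm (αB b) (αA a)) (matched⇒α-sum-zero a b (pB-ok N b a pb))

    unmatched-α-zero : ∀ x → partner x ≡ nothing → αV x ≡ + 0
    unmatched-α-zero (inj₁ a) eq with pA N a in pa
    ... | nothing = unmatchedA⇒α-zero a pa
    unmatched-α-zero (inj₂ b) eq with pB N b in pb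
    ... | nothing = unmatchedB⇒α-zero b pb

    Prefers : VG → VG → Set
    Prefers (inj₁ a) (inj₂ b) = betterA a (just b) (pA N a) ≡ true
    Prefers (inj₂ b) (inj₁ a) = betterB b (just a) (pB N b) ≡ true
    Prefers _        _        = ⊥

    unmatched-Prefers : ∀ x v → Adj x v → partner x ≡ nothing → Prefers x v
    unmatched-Prefers (inj₁ a) (inj₂ b) _ eq with pA N a
    ... | nothing = refl
    unmatched-Prefers (inj₂ b) (inj₁ a) _ eq with pB N b
    ... | nothing = refl

    rank-Prefers : ∀ x v y → Adj x v → partner x ≡ just y → rankV x v ℕ.< rankV x y → Prefers x v
    rank-Prefers x v y adj eq lt with partners x y eq
    rank-Prefers (inj₁ a) (inj₂ b) _ _ _ lt | a→b pa = trans (cong (betterA a (just b)) pa) (<⇒<ᵇ lt)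
    rank-Prefers (inj₂ b) (inj₁ a) _ _ _ lt | b→a pb = trans (cong (betterB b (just a)) pb) (<⇒<ᵇ lt)

    Prefers⇒α-nonneg : ∀ x v → Adj x v → Prefers x v → + 0 ℤ.≤ αV x ℤ.+ αV v
    Prefers⇒α-nonneg (inj₁ a) (inj₂ b) Eab pref = wt-nonneg-A a b Eab pref
    Prefers⇒α-nonneg (inj₂ b) (inj₁ a) Eab pref = subst (+ 0 ℤ.≤_) (ℤP.+-comm (αA a) (αB b)) (wt-nonneg-B a b Eab pref)

    mutual-Prefers⇒α-two : ∀ x v → Adj x v → Prefers x v → Prefers v x → + 2 ℤ.≤ αV x ℤ.+ αV v
    mutual-Prefers⇒α-two (inj₁ a) (inj₂ b) Eab pref pref′ = wt-two a b Eab pref pref′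
    mutual-Prefers⇒α-two (inj₂ b) (inj₁ a) Eab pref pref′ =
      subst (+ 2 ℤ.≤_) (ℤP.+-comm (αA a) (αB b)) (wt-two a b Eab pref′ pref)

    _≟ᵐ_ : DecidableEquality (Maybe VG)
    _≟ᵐ_ = MaybeP.≡-dec (SumP.≡-dec _≟_ _≟_)

    imageH : Edge → Bool
    imageH (nbr x v σ) = does ((partner x ≟ᵐ just v) ×-dec (σ ≟ˢ signOf (αV x)))
    imageH (self u)    = does (partner u ≟ᵐ nothing)

    imageH-nbr : ∀ x v σ → imageH (nbr x v σ) ≡ true → partner x ≡ just v × σ ≡ signOf (αV x)
    imageH-nbr x v σ = decided ((partner x ≟ᵐ just v) ×-dec (σ ≟ˢ signOf (αV x)))

    imageH-self : ∀ u → imageH (self u) ≡ true → partner u ≡ nothing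
    imageH-self u = decided (partner u ≟ᵐ nothing)

    nbr∈imageH : ∀ x v → partner x ≡ just v → imageH (nbr x v (signOf (αV x))) ≡ true
    nbr∈imageH x v eq = dec-true ((partner x ≟ᵐ just v) ×-dec (signOf (αV x) ≟ˢ signOf (αV x))) (eq , refl)

    self∈imageH : ∀ u → partner u ≡ nothing → imageH (self u) ≡ true
    self∈imageH u = dec-true (partner u ≟ᵐ nothing)

    imageH-matching : MatchingH imageH
    imageH-matching = edges , left-unique , right-unique
      where
      edges : ∀ e → imageH e ≡ true → IsHEdge e
      edges (nbr x v σ) e∈ = partner-Adj x v (proj₁ (imageH-nbr x v σ e∈))
      edges (self u)    _  = tt
      left-unique : ∀ e e′ → imageH e ≡ true → imageH e′ ≡ true → left e ≡ left e′ → e ≡ e′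
      left-unique (nbr x v σ) (nbr .x v′ σ′) e∈ e′∈ refl with imageH-nbr x v σ e∈ | imageH-nbr x v′ σ′ e′∈
      ... | xv , refl | xv′ , refl = cong (λ w → nbr x w (signOf (αV x))) (MaybeP.just-injective (trans (sym xv) xv′))
      left-unique (nbr x v σ) (self .x)  e∈ e′∈ refl =
        ⊥-elim (just≢nothing (proj₁ (imageH-nbr x v σ e∈)) (imageH-self x e′∈))
      left-unique (self u) (nbr .u v σ)  e∈ e′∈ refl =
        ⊥-elim (just≢nothing (proj₁ (imageH-nbr u v σ e′∈)) (imageH-self u e∈))
      left-unique (self u) (self .u)     _  _   refl = refl
      right-unique : ∀ e e′ → imageH e ≡ true → imageH e′ ≡ true → right e ≡ right e′ → e ≡ e′
      right-unique (nbr x v σ) (nbr x′ .v σ′) e∈ e′∈ refl with imageH-nbr x v σ e∈ | imageH-nbr x′ v σ′ e′∈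
      ... | xv , refl | x′v , refl with MaybeP.just-injective (trans (sym (partner-sym x v xv)) (partner-sym x′ v x′v))
      ...   | refl = refl
      right-unique (nbr x v σ) (self .v) e∈ e′∈ refl =
        ⊥-elim (just≢nothing (partner-sym x v (proj₁ (imageH-nbr x v σ e∈))) (imageH-self v e′∈))
      right-unique (self u) (nbr x .u σ) e∈ e′∈ refl =
        ⊥-elim (just≢nothing (partner-sym x u (proj₁ (imageH-nbr x u σ e′∈))) (imageH-self u e∈))
      right-unique (self u) (self .u) _ _ refl = refl

    Adj-sym : ∀ x v → Adj x v → Adj v x
    Adj-sym (inj₁ a) (inj₂ b) Eab = Eab
    Adj-sym (inj₂ b) (inj₁ a) Eab = Eab

    partner-of-one : ∀ v w → partner v ≡ just w → αV w ≡ + 1 → αV v ≡ -[1+ 0 ]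
    partner-of-one v w pv αw≡1 =
      In01-1+y≡0⇒y≡-1 (αV-In01 v) (subst (λ z → z ℤ.+ αV v ≡ + 0) αw≡1 (partner-α-sum-zero w v (partner-sym v w pv)))

    LeftBlocks RightBlocks : Edge → Set
    LeftBlocks e  = ∀ e′ → imageH e′ ≡ true → left e′ ≡ left e → prefL e e′
    RightBlocks e = ∀ e′ → imageH e′ ≡ true → right e′ ≡ right e → prefR e e′

    self-not-LeftBlocks : ∀ u → ¬ LeftBlocks (self u)
    self-not-LeftBlocks u L with partner u in pu
    ... | just v  = prefL-self-nbr u u v (signOf (αV u)) (L (nbr u v (signOf (αV u))) (nbr∈imageH u v pu) refl)
    ... | nothing = prefL-irrefl (self u) (L (self u) (self∈imageH u pu) refl)

    plus-LeftBlocks : ∀ x v → Adj x v → LeftBlocks (nbr x v plus) → Prefers x v ⊎ signOf (αV x) ≡ minus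
    plus-LeftBlocks x v adj L with partner x in px
    ... | nothing = inj₁ (unmatched-Prefers x v adj px)
    ... | just y with prefL-plus x v y (signOf (αV x)) (L (nbr x y (signOf (αV x))) (nbr∈imageH x y px) refl)
    ...   | inj₁ x-minus = inj₂ x-minus
    ...   | inj₂ lt      = inj₁ (rank-Prefers x v y adj px lt)

    minus-LeftBlocks : ∀ x v → Adj x v → LeftBlocks (nbr x v minus) → Prefers x v × signOf (αV x) ≡ minus
    minus-LeftBlocks x v adj L with partner x in px
    ... | nothing = unmatched-Prefers x v adj px , cong signOf (unmatched-α-zero x px)
    ... | just y with prefL-minus x v y (signOf (αV x)) (L (nbr x y (signOf (αV x))) (nbr∈imageH x y px) refl)
    ...   | x-minus , lt = rank-Prefers x v y adj px lt , x-minus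

    plus-RightBlocks : ∀ x v → Adj x v → RightBlocks (nbr x v plus) → Prefers v x × αV v ≡ -[1+ 0 ]
    plus-RightBlocks x v adj R with partner v in pv
    ... | nothing = ⊥-elim (prefR-plus-self x v (R (self v) (self∈imageH v pv) refl))
    ... | just w with prefR-plus x v w (signOf (αV w)) (R (nbr w v (signOf (αV w))) (nbr∈imageH w v (partner-sym v w pv)) refl)
    ...   | w-plus , lt = rank-Prefers v x w (Adj-sym x v adj) pv lt , partner-of-one v w pv (signOf-plus (αV w) w-plus)

    minus-RightBlocks : ∀ x v → Adj x v → RightBlocks (nbr x v minus) → Prefers v x ⊎ αV v ≡ -[1+ 0 ]
    minus-RightBlocks x v adj R with partner v in pv
    ... | nothing = inj₁ (unmatched-Prefers v x (Adj-sym x v adj) pv)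
    ... | just w with prefR-minus x v w (signOf (αV w)) (R (nbr w v (signOf (αV w))) (nbr∈imageH w v (partner-sym v w pv)) refl)
    ...   | inj₁ w-plus = inj₂ (partner-of-one v w pv (signOf-plus (αV w) w-plus))
    ...   | inj₂ lt     = inj₁ (rank-Prefers v x w (Adj-sym x v adj) pv lt)

    imageH-unblocked : ∀ e → ¬ Blocking imageH e
    imageH-unblocked (self u) (_ , L , _) = self-not-LeftBlocks u L
    imageH-unblocked (nbr x v plus) (adj , L , R) with plus-RightBlocks x v adj R
    ... | v-prefers , αv≡-1 with plus-LeftBlocks x v adj L
    ...   | inj₁ x-prefers =
      -1≢1 (trans (sym αv≡-1) (proj₂ (In01-2≤x+y⇒x≡y≡1 (αV-In01 x) (αV-In01 v)
                                        (mutual-Prefers⇒α-two x v adj x-prefers v-prefers))))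
      where
      -1≢1 : -[1+ 0 ] ≢ + 1
      -1≢1 ()
    ...   | inj₂ x-minus = signOf-minus (αV x) x-minus (In01-0≤x-1⇒x≡1 (αV-In01 x)
                             (subst (λ z → + 0 ℤ.≤ z) (trans (ℤP.+-comm (αV v) (αV x)) (cong (ℤ._+_ (αV x)) αv≡-1))
                                    (Prefers⇒α-nonneg v x (Adj-sym x v adj) v-prefers)))
    imageH-unblocked (nbr x v minus) (adj , L , R) with minus-LeftBlocks x v adj L | minus-RightBlocks x v adj R
    ... | x-prefers , x-minus | inj₁ v-prefers =
      signOf-minus (αV x) x-minus (proj₁ (In01-2≤x+y⇒x≡y≡1 (αV-In01 x) (αV-In01 v)
                                            (mutual-Prefers⇒α-two x v adj x-prefers v-prefers)))
    ... | x-prefers , x-minus | inj₂ αv≡-1 =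
      signOf-minus (αV x) x-minus (In01-0≤x-1⇒x≡1 (αV-In01 x)
        (subst (λ z → + 0 ℤ.≤ αV x ℤ.+ z) αv≡-1 (Prefers⇒α-nonneg x v adj x-prefers)))

    imageH-stable : Stable imageH
    imageH-stable = imageH-matching , imageH-unblocked

  S0-edge-preferred : ∀ {S0} → LeftOptimalLegalStable S0 → ∀ {e₀} → S0 e₀ ≡ true →
                      ∀ S → LegalStable S → ∀ e → S e ≡ true → left e ≡ left e₀ → e₀ ≡ e ⊎ prefL e₀ e
  S0-edge-preferred ((((_ , left-unique , _) , _) , _) , optimal) {e₀} e₀∈ S S-ls e e∈ same with optimal S S-ls e e∈
  ... | e₀′ , e₀′∈ , left≡ , pref with left-unique e₀′ e₀ e₀′∈ e₀∈ (trans left≡ same)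
  ... | refl = pref

  module OptimalVersusImage {S0 : Edge → Bool} (optimal : LeftOptimalLegalStable S0)
                            (N : Matching) (pop : Popular N) (apop : APopular N)
                            (αA : Fin nA → ℤ) (αB : Fin nB → ℤ) (wit : Witness N αA αB) where
    open APopularFacts N apop
    open WitnessFacts N αA αB wit
    open ImageInH N αA αB wit

    imageH-legal : LegalH imageH
    imageH-legal (nbr x v σ) e∈ with partners x v (proj₁ (imageH-nbr x v σ e∈))
    ... | a→b {a} {b} pa = proj₁ (pA-ok N a b pa) , matched⇒ValidEdge a b pa , N , pop , pa
    ... | b→a {a} {b} pb = proj₁ (pA-ok N a b pa) , matched⇒ValidEdge a b pa , N , pop , pa
      where
      pa : pA N a ≡ just b
      pa = pB-ok N b a pb
    imageH-legal (self (inj₁ a)) e∈ with pA N a in pa | imageH-self (inj₁ a) e∈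
    ... | nothing | _ = unmatched⇒ValidLoopA a pa , N , pop , pa
    imageH-legal (self (inj₂ b)) e∈ with pB N b in pb | imageH-self (inj₂ b) e∈
    ... | nothing | _ = unmatched⇒NotF b pb , N , pop , pb

    imageH-legal-stable : LegalStable imageH
    imageH-legal-stable = imageH-stable , imageH-legal

    B′minus⇒αB≢1 : ∀ b → InB'minus S0 b → αB b ≢ + 1
    B′minus⇒αB≢1 b (a′ , e₀∈) αb≡1 with pB N b in pb
    ... | nothing = 1≢0 (trans (sym αb≡1) (unmatchedB⇒α-zero b pb))
      where
      1≢0 : + 1 ≢ + 0
      1≢0 ()
    ... | just a″ with S0-edge-preferred optimal e₀∈ imageH imageH-legal-stable (nbr (inj₂ b) (inj₁ a″) plus) e∈ refl
      where
      e∈ : imageH (nbr (inj₂ b) (inj₁ a″) plus) ≡ true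
      e∈ = subst (λ s → imageH (nbr (inj₂ b) (inj₁ a″) s) ≡ true) (cong signOf αb≡1)
                 (nbr∈imageH (inj₂ b) (inj₁ a″) (cong (Maybe.map inj₁) pb))
    ...   | inj₁ ()
    ...   | inj₂ pref with proj₁ (prefL-minus (inj₂ b) (inj₁ a′) (inj₁ a″) plus pref)
    ...     | ()

    Bplus⇒αB≢-1 : ∀ b → InBplus S0 b → αB b ≢ -[1+ 0 ]
    Bplus⇒αB≢-1 b (a , e₀∈) αb≡-1 = imageH-unblocked e₀ (Eab , left-blocks , right-blocks)
      where
      e₀ : Edge
      e₀ = nbr (inj₁ a) (inj₂ b) minus
      Eab : E a b ≡ true
      Eab = proj₁ (proj₂ (proj₁ optimal) e₀ e₀∈)
      partner-of-b : ∀ x → partner x ≡ just (inj₂ b) → αV x ≡ + 1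
      partner-of-b x px = In01-0≤x-1⇒x≡1 (αV-In01 x)
        (ℤP.≤-reflexive (sym (subst (λ z → αV x ℤ.+ z ≡ + 0) αb≡-1 (partner-α-sum-zero x (inj₂ b) px))))
      left-blocks : LeftBlocks e₀
      left-blocks e e∈ same with S0-edge-preferred optimal e₀∈ imageH imageH-legal-stable e e∈ same
      ... | inj₂ pref = pref
      ... | inj₁ refl with imageH-nbr (inj₁ a) (inj₂ b) minus e∈
      ...   | pa , minus≡ = ⊥-elim (signOf-minus (αA a) (sym minus≡) (partner-of-b (inj₁ a) pa))
      right-blocks : RightBlocks e₀
      right-blocks (self u) _ _ = inj₁ (s≤s z≤n)
      right-blocks (nbr x .(inj₂ b) σ) e∈ refl with imageH-nbr x (inj₂ b) σ e∈
      ... | px , σ≡ with trans σ≡ (cong signOf (partner-of-b x px))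
      ...   | refl = inj₁ (s≤s z≤n)

    αB-zero-on-B₊∩B′₋ : ∀ b → InBplus S0 b → InB'minus S0 b → αB b ≡ + 0
    αB-zero-on-B₊∩B′₋ b b∈B₊ b∈B′₋ with αB-In01 b
    ... | inj₁ αb≡0         = αb≡0
    ... | inj₂ (inj₁ αb≡1)  = ⊥-elim (B′minus⇒αB≢1 b b∈B′₋ αb≡1)
    ... | inj₂ (inj₂ αb≡-1) = ⊥-elim (Bplus⇒αB≢-1 b b∈B₊ αb≡-1)

lemma3 : (I : Instance) → let open Theory I in
    (S0 : Edge → Bool) → LeftOptimalLegalStable S0 →
    (N : Matching) → FullyPopular N →
    (αA : Fin (Instance.nA I) → ℤ) (αB : Fin (Instance.nB I) → ℤ) → Witness N αA αB →
    (b : Fin (Instance.nB I)) → InBplus S0 b → InB'minus S0 b → αB b ≡ + 0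
lemma3 I S0 optimal N (pop , apop) αA αB wit =
  OptimalVersusImage.αB-zero-on-B₊∩B′₋ I optimal N pop apop αA αB wit
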